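{- If a logical structure $(\mathscr{L},W)$ has an adequate type-I $S$-semantics (i.e. $W=W^{\mathsf{S}}_I$ for some $S$-semantics $\mathsf{S}$ for $\mathscr{L}$), then it has an adequate semantics (i.e. $W=W_{\mathfrak{S}}$ for some semantics $\mathfrak{S}$ for $\mathscr{L}$).
   Context: A logical structure is a pair $(\mathscr{L},W)$ with $W:\mathcal{P}(\mathscr{L})\to\mathcal{P}(\mathscr{L})$. An $S$-semantics for $\mathscr{L}$ is a tuple $\mathsf{S}=(\mathbf{B},R,\models,\mathcal{P}(\mathscr{L}))$ with $\mathbf{B}\subseteq\{0,1\}^{\mathscr{L}}$, $R\subseteq\mathbf{B}\times\mathbf{B}$, $\models\subseteq\mathbf{B}\times\mathcal{P}(\mathscr{L})$; $W^{\mathsf{S}}_I$ is defined by: $\alpha\in W^{\mathsf{S}}_I(\Gamma)$ iff for all $(v,w)\in R$, $v\models\Gamma$ implies $w\models\{\alpha\}$. A semantics for $\mathscr{L}$ is a tuple $\mathfrak{S}=(\mathbf{M},\{\models_i\}_{i\in I},S,\mathcal{P}(\mathscr{L}))$ where $\mathbf{M}$ is a set, $I\neq\emptyset$, each $\models_i\subseteq\mathbf{M}\times\mathcal{P}(\mathscr{L})$, and $\emptyset\subsetneq S\subseteq\{(\models_i,\models_j):(i,j)\in I\times I\}$; $W_{\mathfrak{S}}$ is defined by: $\alpha\in W_{\mathfrak{S}}(\Gamma)$ iff for all $(\models_i,\models_j)\in S$ and all $m\in\mathbf{M}$, $m\models_i\Gamma$ implies $m\models_j\{\alpha\}$. -}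

module Defs where

open import Level using (0ℓ)
open import Data.Bool using (Bool)
open import Data.Product using (Σ; ∃; _×_; _,_)
open import Relation.Unary using (Pred; _⊆_; _∈_; ｛_｝)
open import Function.Bundles using (_⇔_)

Sub : Set → Set₁
Sub 𝓛 = Pred 𝓛 0ℓ

Consequence : Set → Set₁
Consequence 𝓛 = Sub 𝓛 → Sub 𝓛

_≐_ : {𝓛 : Set} → Consequence 𝓛 → Consequence 𝓛 → Set₁
_≐_ {𝓛} W W' = (Γ : Sub 𝓛) (α : 𝓛) → (α ∈ W Γ) ⇔ (α ∈ W' Γ)

Val : Set → Set
Val 𝓛 = 𝓛 → Bool

record SSemantics (𝓛 : Set) : Set₁ where
  field
    B   : Pred (Val 𝓛) 0ℓ
    R   : (v w : Val 𝓛) → v ∈ B → w ∈ B → Set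
    sat : (v : Val 𝓛) → v ∈ B → Sub 𝓛 → Set

W-I : {𝓛 : Set} → SSemantics 𝓛 → Consequence 𝓛
W-I {𝓛} 𝐒 Γ α =
  (v w : Val 𝓛) (v∈B : v ∈ B) (w∈B : w ∈ B) → R v w v∈B w∈B →
  sat v v∈B Γ → sat w w∈B ｛ α ｝
  where open SSemantics 𝐒

-- A semantics (M, {⊨_i}_{i∈I}, S, P(𝓛)) for 𝓛.  S is given as a set of
-- index pairs (i , j), standing for the pair (⊨_i , ⊨_j).
record Semantics (𝓛 : Set) : Set₁ where
  field
    M    : Set
    I    : Set
    I-ne : I
    sat  : I → M → Sub 𝓛 → Set
    S    : I → I → Set
    S-ne : Σ I λ i → Σ I λ j → S i j

W-sem : {𝓛 : Set} → Semantics 𝓛 → Consequence 𝓛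
W-sem {𝓛} 𝔖 Γ α =
  (i j : I) → S i j → (m : M) → sat i m Γ → sat j m ｛ α ｝
  where open Semantics 𝔖

{-# OPTIONS --safe #-}
module Submission where

-- Every R-edge (v , w) of the S-semantics becomes a model; it satisfies Γ
-- under ⊨_source when v ⊨ Γ and under ⊨_target when w ⊨ Γ. With the single
-- pair S = {(⊨_source , ⊨_target)}, quantifying over models is quantifying
-- over R, so both definitions of consequence unfold to the same condition.

open import Defs
open import Data.Product using (Σ; _,_)
open import Function.Bundles using (mk⇔)
open import Function.Construct.Composition using (_⇔-∘_)
open import Relation.Unary using (_∈_)

≐-trans : {𝓛 : Set} {W W′ W″ : Consequence 𝓛} → W ≐ W′ → W′ ≐ W″ → W ≐ W″
≐-trans W≐W′ W′≐W″ Γ α = W′≐W″ Γ α ⇔-∘ W≐W′ Γ α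

module _ {𝓛 : Set} (𝐒 : SSemantics 𝓛) where
  open SSemantics 𝐒

  record Edge : Set where
    constructor edge
    field
      {source target} : Val 𝓛
      source∈B        : source ∈ B
      target∈B        : target ∈ B
      related         : R source target source∈B target∈B

  data Endpoint : Set where
    source target : Endpoint

  data SourceToTarget : Endpoint → Endpoint → Set where
    source→target : SourceToTarget source target

  satAt : Endpoint → Edge → Sub 𝓛 → Set
  satAt source (edge v∈B _ _) = sat _ v∈B
  satAt target (edge _ w∈B _) = sat _ w∈B

  edgeSemantics : Semantics 𝓛
  edgeSemantics = record
    { M    = Edge
    ; I    = Endpoint
    ; I-ne = source
    ; sat  = satAt
    ; S    = SourceToTarget
    ; S-ne = source , target , source→target
    }

  W-I≐W-sem-edgeSemantics : W-I 𝐒 ≐ W-sem edgeSemantics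
  W-I≐W-sem-edgeSemantics Γ α = mk⇔ W-I⊆W-sem W-sem⊆W-I
    where
    W-I⊆W-sem : α ∈ W-I 𝐒 Γ → α ∈ W-sem edgeSemantics Γ
    W-I⊆W-sem α∈W source target source→target (edge v∈B w∈B vRw) = α∈W _ _ v∈B w∈B vRw

    W-sem⊆W-I : α ∈ W-sem edgeSemantics Γ → α ∈ W-I 𝐒 Γ
    W-sem⊆W-I α∈W _ _ v∈B w∈B vRw = α∈W source target source→target (edge v∈B w∈B vRw)

mainTheorem18 : (𝓛 : Set) (W : Consequence 𝓛) →
    Σ (SSemantics 𝓛) (λ 𝐒 → W ≐ W-I 𝐒) →
    Σ (Semantics 𝓛) (λ 𝔖 → W ≐ W-sem 𝔖)
mainTheorem18 _ _ (𝐒 , W≐W-I) =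
  edgeSemantics 𝐒 , ≐-trans W≐W-I (W-I≐W-sem-edgeSemantics 𝐒)
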